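{- Let $G_1$ and $G_2$ be finite groups. Then there exist generalizations $W_1$ on $P(G_1)$ and $W_2$ on $P(G_2)$ such that the power graph $P(G_1\times G_2)$ is isomorphic to the generalized product $P(G_1)\,{}_{W_1}\!\times_{W_2}P(G_2)$.
   Context: For a finite group $G$, the power graph $P(G)$ is the simple undirected graph with vertex set $G$ in which two distinct vertices $a,b$ are adjacent if $a^m=b$ or $b^n=a$ for some positive integers $m,n$. $\mathbb{N}$ denotes the set of positive integers and $\mathbb{Z}^\sharp=\mathbb{N}\cup\{0\}$. For integers $a,d$, $AP(a,d)=\{a+kd : k\in\mathbb{Z}^\sharp\}$ (so $AP(a,0)=\{a\}$). For a graph $\Gamma$, $A(\Gamma)$ is its arc set, i.e. the set of ordered pairs $(u,v)$ of adjacent vertices, and $\triangle=\{(v,v): v\in V(\Gamma)\}$. A generalization on $\Gamma$ is a function $W: A(\Gamma)\cup\triangle\to\mathbb{Z}^\sharp\times\mathbb{Z}^\sharp$. Given graphs $\Gamma_1,\Gamma_2$ with generalizations $W_1,W_2$, the generalized product $\Gamma_1\,{}_{W_1}\!\times_{W_2}\Gamma_2$ has vertex set $V(\Gamma_1)\times V(\Gamma_2)$, and $(g_1,g_2)\sim(g_1',g_2')$ if and only if (i) $(g_1,g_2)\neq(g_1',g_2')$ and (ii) $AP(W_1(g_1,g_1'))\cap AP(W_2(g_2,g_2'))\cap\mathbb{N}\neq\emptyset$ or $AP(W_1(g_1',g_1))\cap AP(W_2(g_2',g_2))\cap\mathbb{N}\neq\emptyset$ (each alternative in (ii) being understood to require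 that the pairs involved lie in the domains of $W_1$, $W_2$ respectively). -}

module Defs where

open import Data.Nat using (ℕ; zero; suc; _+_; _*_; _≥_)
open import Data.Fin using (Fin)
open import Data.Product using (Σ; ∃; ∃-syntax; _×_; _,_; proj₁; proj₂)
open import Data.Sum using (_⊎_)
open import Relation.Nullary using (¬_)
open import Relation.Binary.PropositionalEquality using (_≡_)
open import Algebra.Structures using (IsGroup)
open import Function.Bundles using (_↔_; Inverse; _⇔_)

record FiniteGroup : Set₁ where
  field
    Carrier : Set
    _∙_     : Carrier → Carrier → Carrier
    ε       : Carrier
    _⁻¹     : Carrier → Carrier
    isGroup : IsGroup _≡_ _∙_ ε _⁻¹
    size    : ℕ
    enum    : Carrier ↔ Fin size

record Graph : Set₁ where
  field
    V   : Set
    Adj : V → V → Set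

open Graph

_≅_ : Graph → Graph → Set
Γ ≅ Δ = Σ (V Γ ↔ V Δ) λ f →
  ∀ u v → Adj Γ u v ⇔ Adj Δ (Inverse.to f u) (Inverse.to f v)

pow : {A : Set} → (A → A → A) → A → A → ℕ → A
pow _∙_ e a zero    = e
pow _∙_ e a (suc m) = a ∙ pow _∙_ e a m

rawPowerGraph : (A : Set) → (A → A → A) → A → Graph
rawPowerGraph A _∙_ e = record
  { V   = A
  ; Adj = λ a b → ¬ (a ≡ b) ×
      ((∃[ m ] (m ≥ 1 × pow _∙_ e a m ≡ b)) ⊎
       (∃[ n ] (n ≥ 1 × pow _∙_ e b n ≡ a)))
  }

P : FiniteGroup → Graph
P G = rawPowerGraph Carrier _∙_ ε
  where open FiniteGroup G

P× : FiniteGroup → FiniteGroup → Graph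
P× G₁ G₂ = rawPowerGraph (G₁.Carrier × G₂.Carrier)
  (λ x y → (G₁._∙_ (proj₁ x) (proj₁ y)) , (G₂._∙_ (proj₂ x) (proj₂ y)))
  (G₁.ε , G₂.ε)
  where
    module G₁ = FiniteGroup G₁
    module G₂ = FiniteGroup G₂

InDom : (Γ : Graph) → V Γ → V Γ → Set
InDom Γ u v = Adj Γ u v ⊎ u ≡ v

-- A generalization W : A(Γ) ∪ △ → ℤ♯ × ℤ♯, represented as a total
-- function whose values are only ever consulted on the domain InDom Γ.
Generalization : Graph → Set
Generalization Γ = V Γ → V Γ → ℕ × ℕ

_∈AP_ : ℕ → ℕ × ℕ → Set
x ∈AP (a , d) = ∃[ k ] (a + k * d ≡ x)

APMeet : ℕ × ℕ → ℕ × ℕ → Set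
APMeet p q = ∃[ x ] (x ≥ 1 × x ∈AP p × x ∈AP q)

genProduct : (Γ₁ : Graph) → Generalization Γ₁ →
             (Γ₂ : Graph) → Generalization Γ₂ → Graph
genProduct Γ₁ W₁ Γ₂ W₂ = record
  { V   = V Γ₁ × V Γ₂
  ; Adj = λ { (g₁ , g₂) (g₁′ , g₂′) →
      ¬ ((g₁ , g₂) ≡ (g₁′ , g₂′)) ×
      ((InDom Γ₁ g₁ g₁′ × InDom Γ₂ g₂ g₂′ × APMeet (W₁ g₁ g₁′) (W₂ g₂ g₂′)) ⊎
       (InDom Γ₁ g₁′ g₁ × InDom Γ₂ g₂′ g₂ × APMeet (W₁ g₁′ g₁) (W₂ g₂′ g₂))) }
  }

-- For a in a finite group, the exponents m ≥ 1 with a ^ m = b are, if there are any, exactly the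
-- positive terms of the progression m₀ + k · o(a), where m₀ is the least of them and o(a) is the
-- order of a; if there are none, they are the positive terms of AP(0,0) = {0}. So with W(a,b)
-- this pair of parameters, (a₁,a₂) ^ m = (b₁,b₂) iff m ≥ 1 lies in both progressions
-- W₁(a₁,b₁) and W₂(a₂,b₂), and the identity map is an isomorphism P(G₁ × G₂) ≅ P(G₁) ×_W P(G₂).
module Submission where

open import Defs
open import Algebra.Bundles using (Group)
open import Algebra.Structures using (IsGroup)
open import Level using (0ℓ)
open import Data.Fin.Properties using (pigeonhole; inj⇒≟)
open import Data.Fin using (toℕ)
open import Data.Nat using (ℕ; zero; suc; _+_; _*_; _<_; _≥_; s≤s)
open import Data.Nat.DivMod using (_%_; _/_; m≡m%n+[m/n]*n; m%n<n)
open import Data.Nat.Properties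
  using (anyUpTo?; m<1+n⇒m<n∨m≡n; n<1+n; ≮⇒≥; m≤n⇒∃[o]m+o≡n; *-zeroʳ; +-identityʳ; <⇒≢; <⇒≤)
open import Data.Product using (∃; ∃-syntax; _×_; _,_; proj₁; proj₂)
open import Data.Sum using (_⊎_; inj₁; inj₂; [_,_])
open import Function.Bundles using (Inverse; Injection; Equivalence; _⇔_; mk⇔)
open import Function.Construct.Identity using (↔-id; ⇔-id)
open import Data.Sum.Function.Propositional using (_⊎-⇔_)
open import Data.Product.Function.NonDependent.Propositional using (_×-⇔_)
open import Function.Properties.Inverse using (↔⇒↣)
open import Relation.Nullary using (¬_; Dec; yes; no; contradiction)
open import Relation.Nullary.Decidable using (map′)
open import Relation.Unary using (Decidable)
open import Relation.Binary.PropositionalEquality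
  using (_≡_; refl; sym; trans; cong; cong₂; module ≡-Reasoning)

record Least (Q : ℕ → Set) : Set where
  field
    value   : ℕ
    holds   : Q value
    minimal : ∀ {k} → k < value → ¬ Q k

module _ {Q : ℕ → Set} (Q? : Decidable Q) where

  leastBelow? : ∀ n → Least Q ⊎ (∀ {k} → k < n → ¬ Q k)
  leastBelow? zero = inj₂ λ ()
  leastBelow? (suc n) with leastBelow? n
  ... | inj₁ l = inj₁ l
  ... | inj₂ none with Q? n
  ...   | yes q = inj₁ record { value = n ; holds = q ; minimal = none }
  ...   | no ¬q = inj₂ λ k<1+n → [ none , (λ { refl → ¬q }) ] (m<1+n⇒m<n∨m≡n k<1+n)

  least : ∀ {n} → Q n → Least Q
  least {n} q with leastBelow? (suc n)
  ... | inj₁ l = l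
  ... | inj₂ none = contradiction q (none (n<1+n n))

PowerOf : {A : Set} → (A → A → A) → A → A → A → Set
PowerOf _∙_ e a b = ∃[ m ] (m ≥ 1 × pow _∙_ e a m ≡ b)

pow-× : ∀ {A B : Set} (_∙_ : A → A → A) (_∘_ : B → B → B) (e : A) (f : B) a b n →
  pow (λ x y → (proj₁ x ∙ proj₁ y) , (proj₂ x ∘ proj₂ y)) (e , f) (a , b) n
    ≡ (pow _∙_ e a n , pow _∘_ f b n)
pow-× _∙_ _∘_ e f a b zero    = refl
pow-× _∙_ _∘_ e f a b (suc n) = cong₂ _,_ (cong (a ∙_) (cong proj₁ ih)) (cong (b ∘_) (cong proj₂ ih))
  where ih = pow-× _∙_ _∘_ e f a b n

module Exponents (G : FiniteGroup) where
  open FiniteGroup G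
  open IsGroup isGroup using (assoc; identityˡ; identityʳ)

  group : Group 0ℓ 0ℓ
  group = record { isGroup = isGroup }

  open import Algebra.Properties.Group group using (∙-cancelˡ)

  infixr 25 _^_
  infix 4 _≟_

  _^_ : Carrier → ℕ → Carrier
  a ^ n = pow _∙_ ε a n

  _≟_ : (a b : Carrier) → Dec (a ≡ b)
  _≟_ = inj⇒≟ (↔⇒↣ enum)

  ^-+ : ∀ a m n → a ^ (m + n) ≡ (a ^ m) ∙ (a ^ n)
  ^-+ a zero    n = sym (identityˡ _)
  ^-+ a (suc m) n = trans (cong (a ∙_) (^-+ a m n)) (sym (assoc _ _ _))

  ^-*-ε : ∀ a {o} k → a ^ o ≡ ε → a ^ (k * o) ≡ ε
  ^-*-ε a zero    e = refl
  ^-*-ε a {o} (suc k) e = begin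
    a ^ (o + k * o)         ≡⟨ ^-+ a o (k * o) ⟩
    (a ^ o) ∙ (a ^ (k * o)) ≡⟨ cong₂ _∙_ e (^-*-ε a k e) ⟩
    ε ∙ ε                   ≡⟨ identityˡ ε ⟩
    ε                       ∎
    where open ≡-Reasoning

  ^-+-cancel : ∀ a m n → a ^ (m + n) ≡ a ^ m → a ^ n ≡ ε
  ^-+-cancel a m n e = ∙-cancelˡ (a ^ m) _ _ (trans (sym (^-+ a m n)) (trans e (sym (identityʳ _))))

  ^-period : ∀ a → ∃[ p ] a ^ suc p ≡ ε
  ^-period a with pigeonhole (n<1+n size) (λ i → Inverse.to enum (a ^ toℕ i))
  ... | i , j , i<j , e with m≤n⇒∃[o]m+o≡n (<⇒≤ i<j)
  ...   | zero  , i+0≡j = contradiction (trans (sym (+-identityʳ _)) i+0≡j) (<⇒≢ i<j)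
  ...   | suc p , i+d≡j = p , ^-+-cancel a (toℕ i) (suc p) (begin
    a ^ (toℕ i + suc p) ≡⟨ cong (a ^_) i+d≡j ⟩
    a ^ toℕ j           ≡⟨ sym (Injection.injective (↔⇒↣ enum) e) ⟩
    a ^ toℕ i           ∎)
    where open ≡-Reasoning

  orderLeast : ∀ a → Least (λ n → a ^ suc n ≡ ε)
  orderLeast a = let p , aᵖ⁺¹≡ε = ^-period a in least (λ n → a ^ suc n ≟ ε) {p} aᵖ⁺¹≡ε

  order : Carrier → ℕ
  order a = suc (Least.value (orderLeast a))

  ^-order : ∀ a → a ^ order a ≡ ε
  ^-order a = Least.holds (orderLeast a)

  ^-%-order : ∀ a y → a ^ y ≡ a ^ (y % order a)
  ^-%-order a y = begin
    a ^ y                     ≡⟨ cong (a ^_) (m≡m%n+[m/n]*n y (order a)) ⟩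
    a ^ (r + q * order a)     ≡⟨ ^-+ a r (q * order a) ⟩
    a ^ r ∙ a ^ (q * order a) ≡⟨ cong (a ^ r ∙_) (^-*-ε a q (^-order a)) ⟩
    a ^ r ∙ ε                 ≡⟨ identityʳ _ ⟩
    a ^ r                     ∎
    where
      open ≡-Reasoning
      r = y % order a
      q = y / order a

  ^≡ε⇒%order≡0 : ∀ a y → a ^ y ≡ ε → y % order a ≡ 0
  ^≡ε⇒%order≡0 a y e with y % order a | m%n<n y (order a) | trans (sym (^-%-order a y)) e
  ... | zero  | _       | _  = refl
  ... | suc r | s≤s r<v | e′ = contradiction e′ (Least.minimal (orderLeast a) r<v)

  ^≡ε⇒order∣ : ∀ a {y} → a ^ y ≡ ε → ∃[ k ] k * order a ≡ y
  ^≡ε⇒order∣ a {y} e = y / order a , (begin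
    y / order a * order a                 ≡⟨ cong (_+ y / order a * order a) (sym (^≡ε⇒%order≡0 a y e)) ⟩
    y % order a + y / order a * order a   ≡⟨ sym (m≡m%n+[m/n]*n y (order a)) ⟩
    y                                     ∎)
    where open ≡-Reasoning

  exponent? : ∀ a b → Dec (∃[ x ] a ^ suc x ≡ b)
  exponent? a b = map′
    (λ (x , _ , e) → x , e)
    (λ (x , e) → x % order a , m%n<n x (order a) , trans (sym (cong (a ∙_) (^-%-order a x))) e)
    (anyUpTo? (λ x → a ^ suc x ≟ b) (order a))

  exponentsAP : ∀ a b → Dec (∃[ x ] a ^ suc x ≡ b) → ℕ × ℕ
  exponentsAP a b (yes (x , e)) = suc (Least.value (least (λ y → a ^ suc y ≟ b) {x} e)) , order a
  exponentsAP a b (no _)        = 0 , 0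

  ∈exponentsAP⇔ : ∀ a b d x → suc x ∈AP exponentsAP a b d ⇔ a ^ suc x ≡ b
  ∈exponentsAP⇔ a b (no ∄) x =
    mk⇔ (λ (k , 0+k*0≡1+x) → contradiction (trans (sym (*-zeroʳ k)) 0+k*0≡1+x) λ ())
        (λ e → contradiction (x , e) ∄)
  ∈exponentsAP⇔ a b (yes (y , e)) x = mk⇔ to from
    where
      open Least (least (λ y → a ^ suc y ≟ b) {y} e)
      open ≡-Reasoning

      to : suc x ∈AP (suc value , order a) → a ^ suc x ≡ b
      to (k , m+ko≡1+x) = begin
        a ^ suc x                         ≡⟨ cong (a ^_) (sym m+ko≡1+x) ⟩
        a ^ (suc value + k * order a)     ≡⟨ ^-+ a (suc value) (k * order a) ⟩
        a ^ suc value ∙ a ^ (k * order a) ≡⟨ cong₂ _∙_ holds (^-*-ε a k (^-order a)) ⟩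
        b ∙ ε                             ≡⟨ identityʳ b ⟩
        b                                 ∎

      from : a ^ suc x ≡ b → suc x ∈AP (suc value , order a)
      from e′ with m≤n⇒∃[o]m+o≡n (≮⇒≥ (λ x<value → minimal x<value e′))
      ... | d , value+d≡x with ^≡ε⇒order∣ a (^-+-cancel a (suc value) d aᵐ⁺ᵈ≡aᵐ)
        where
          aᵐ⁺ᵈ≡aᵐ : a ^ (suc value + d) ≡ a ^ suc value
          aᵐ⁺ᵈ≡aᵐ = trans (cong (λ n → a ^ suc n) value+d≡x) (trans e′ (sym holds))
      ...   | k , k*o≡d = k , cong suc (trans (cong (value +_) k*o≡d) value+d≡x)

  -- Opaque so that comparing W a b with W a′ b′ never unfolds the search for the order of a.
  opaque
    W : Carrier → Carrier → ℕ × ℕ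
    W a b = exponentsAP a b (exponent? a b)

  opaque
    unfolding W

    ∈W⇔ : ∀ {a b x} → x ≥ 1 → x ∈AP W a b ⇔ a ^ x ≡ b
    ∈W⇔ {a} {b} {suc x} _ = ∈exponentsAP⇔ a b (exponent? a b) x

  ^⇒InDom : ∀ {a b m} → m ≥ 1 → a ^ m ≡ b → InDom (P G) a b
  ^⇒InDom {a} {b} {m} m≥1 e with a ≟ b
  ... | yes a≡b = inj₂ a≡b
  ... | no  a≢b = inj₁ (a≢b , inj₁ (m , m≥1 , e))

module ProductPowerGraph (G₁ G₂ : FiniteGroup) where
  module G₁ = FiniteGroup G₁
  module G₂ = FiniteGroup G₂
  module E₁ = Exponents G₁
  module E₂ = Exponents G₂

  _∙×_ : G₁.Carrier × G₂.Carrier → G₁.Carrier × G₂.Carrier → G₁.Carrier × G₂.Carrier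
  x ∙× y = G₁._∙_ (proj₁ x) (proj₁ y) , G₂._∙_ (proj₂ x) (proj₂ y)

  powerOf⇔arc : ∀ a₁ a₂ b₁ b₂ →
    PowerOf _∙×_ (G₁.ε , G₂.ε) (a₁ , a₂) (b₁ , b₂)
      ⇔ (InDom (P G₁) a₁ b₁ × InDom (P G₂) a₂ b₂ × APMeet (E₁.W a₁ b₁) (E₂.W a₂ b₂))
  powerOf⇔arc a₁ a₂ b₁ b₂ = mk⇔ to from
    where
      ^-× : ∀ m → pow _∙×_ (G₁.ε , G₂.ε) (a₁ , a₂) m ≡ (a₁ E₁.^ m , a₂ E₂.^ m)
      ^-× = pow-× G₁._∙_ G₂._∙_ G₁.ε G₂.ε a₁ a₂

      to : PowerOf _∙×_ (G₁.ε , G₂.ε) (a₁ , a₂) (b₁ , b₂) →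
           InDom (P G₁) a₁ b₁ × InDom (P G₂) a₂ b₂ × APMeet (E₁.W a₁ b₁) (E₂.W a₂ b₂)
      to (m , m≥1 , e) =
        E₁.^⇒InDom m≥1 e₁ , E₂.^⇒InDom m≥1 e₂ ,
        m , m≥1 , Equivalence.from (E₁.∈W⇔ m≥1) e₁ , Equivalence.from (E₂.∈W⇔ m≥1) e₂
        where
          e₁ = cong proj₁ (trans (sym (^-× m)) e)
          e₂ = cong proj₂ (trans (sym (^-× m)) e)

      from : InDom (P G₁) a₁ b₁ × InDom (P G₂) a₂ b₂ × APMeet (E₁.W a₁ b₁) (E₂.W a₂ b₂) →
             PowerOf _∙×_ (G₁.ε , G₂.ε) (a₁ , a₂) (b₁ , b₂)
      from (_ , _ , x , x≥1 , x∈W₁ , x∈W₂) = x , x≥1 , trans (^-× x)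
        (cong₂ _,_ (Equivalence.to (E₁.∈W⇔ x≥1) x∈W₁) (Equivalence.to (E₂.∈W⇔ x≥1) x∈W₂))

  Adj-P×⇔Adj-genProduct : ∀ u v →
    Graph.Adj (P× G₁ G₂) u v ⇔ Graph.Adj (genProduct (P G₁) E₁.W (P G₂) E₂.W) u v
  Adj-P×⇔Adj-genProduct (a₁ , a₂) (b₁ , b₂) =
    ⇔-id _ ×-⇔ (powerOf⇔arc a₁ a₂ b₁ b₂ ⊎-⇔ powerOf⇔arc b₁ b₂ a₁ a₂)

mainTheorem3 : (G₁ G₂ : FiniteGroup) →
    ∃[ W₁ ] ∃[ W₂ ] (P× G₁ G₂ ≅ genProduct (P G₁) W₁ (P G₂) W₂)
mainTheorem3 G₁ G₂ = E₁.W , E₂.W , ↔-id _ , Adj-P×⇔Adj-genProduct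
  where open ProductPowerGraph G₁ G₂
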